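{- Let $N$ be a nonzero integer and $\mathbf{M}\colon\mathcal{I}\times\mathcal{J}\to\mathbb{Z}$ a tame $N$-tiling, and write $\Delta(i,i';j,j')=m_{i,j}m_{i',j'}-m_{i,j'}m_{i',j}$. For all $i<i'$ in $\mathcal{I}$ and $j<j'$ in $\mathcal{J}$, \[ N\,\Delta(i,i';j,j')=\Delta(i,i+1;j,j')\,\Delta(i,i';j,j+1). \]
   Context: Index sets $\mathcal{I},\mathcal{J}$ are sets of consecutive integers of length at least 3 (possibly infinite). An $N$-tiling is a function $\mathbf{M}\colon\mathcal{I}\times\mathcal{J}\to\mathbb{Z}$, $m_{ij}=\mathbf{M}(i,j)$, with $m_{ij}m_{i+1,j+1}-m_{i,j+1}m_{i+1,j}=N$ for every contiguous $2\times2$ subblock; it is tame if every contiguous $3\times3$ subblock has determinant $0$. -}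

module Defs where

open import Level using (0ℓ)
open import Data.Integer using (ℤ; _+_; _-_; _*_; _<_; _≤_; 0ℤ; 1ℤ)
open import Data.Product using (Σ; ∃; _×_; _,_)
open import Relation.Binary.PropositionalEquality using (_≡_)
open import Relation.Nullary using (¬_)

-- An index set: a set of consecutive integers (an interval of ℤ, possibly
-- infinite in either or both directions) with at least 3 elements,
-- given by its membership predicate.
record IndexSet : Set₁ where
  field
    mem : ℤ → Set
    convex : ∀ {a b c} → mem a → mem c → a ≤ b → b ≤ c → mem b
    three : ∃ λ a → mem a × mem (a + 1ℤ) × mem ((a + 1ℤ) + 1ℤ)

open IndexSet public

-- Matrix entries: a function ℤ → ℤ → ℤ; only values on I × J matter.
Matrix : Set
Matrix = ℤ → ℤ → ℤ

Δ : Matrix → ℤ → ℤ → ℤ → ℤ → ℤ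
Δ M i i' j j' = M i j * M i' j' - M i j' * M i' j

det3 : ℤ → ℤ → ℤ → ℤ → ℤ → ℤ → ℤ → ℤ → ℤ → ℤ
det3 a b c d e f g h k =
  (a * (e * k - f * h) - b * (d * k - f * g)) + c * (d * h - e * g)

IsTiling : IndexSet → IndexSet → ℤ → Matrix → Set
IsTiling I J N M =
  ∀ i j → mem I i → mem I (i + 1ℤ) → mem J j → mem J (j + 1ℤ) →
  M i j * M (i + 1ℤ) (j + 1ℤ) - M i (j + 1ℤ) * M (i + 1ℤ) j ≡ N

IsTame : IndexSet → IndexSet → Matrix → Set
IsTame I J M =
  ∀ i j → mem I i → mem I (i + 1ℤ + 1ℤ) → mem J j → mem J (j + 1ℤ + 1ℤ) →
  det3 (M i j)              (M i (j + 1ℤ))              (M i (j + 1ℤ + 1ℤ))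
       (M (i + 1ℤ) j)       (M (i + 1ℤ) (j + 1ℤ))       (M (i + 1ℤ) (j + 1ℤ + 1ℤ))
       (M (i + 1ℤ + 1ℤ) j)  (M (i + 1ℤ + 1ℤ) (j + 1ℤ))  (M (i + 1ℤ + 1ℤ) (j + 1ℤ + 1ℤ))
    ≡ 0ℤ

{-# OPTIONS --safe #-}
module Submission where

-- Along a tame N-tiling every row k ≥ i obeys the second-order recurrence
-- N (m k c + m k (c+2)) = A m k (c+1) with the single coefficient A = Δ(i,i+1;c,c+2):
-- rows i and i+1 do because their adjacent minors equal N, and each further row does
-- because its 3×3 block is singular while the 2×2 minor above it is N ≠ 0.
-- Both Δ(i,i';j,c) and Δ(i,i+1;j,c) are combinations of rows, so
-- c ↦ N Δ(i,i';j,c) - Δ(i,i+1;j,c) Δ(i,i';j,j+1) obeys the same recurrence; it vanishes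
-- at c = j and c = j+1, and since N ≠ 0 the recurrence propagates the vanishing.

open import Defs
open import Data.Integer using (ℤ; _+_; _-_; _*_; _<_; _≤_; +_; +≤+; 0ℤ; 1ℤ; ∣_∣; NonZero)
open import Data.Integer.Base using (≢-nonZero)
import Data.Integer.Properties as ℤ
open import Data.Integer.Tactic.RingSolver using (solve-∀; solve)
open import Data.List using (_∷_; [])
open import Data.Nat using (zero; suc)
import Data.Nat as ℕ
import Data.Nat.Properties as ℕ
open import Data.Product using (_×_; _,_; proj₁; proj₂)
open import Relation.Binary.PropositionalEquality
open import Relation.Nullary using (¬_)
open ≡-Reasoning

-- A record rather than the bare equation, so that the entries can be recovered by unification.
record Recurrence (N A x₀ x₁ x₂ : ℤ) : Set where
  constructor recurrence
  field
    equation : N * (x₀ + x₂) ≡ A * x₁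

recurrence-combine : ∀ {N A x₀ x₁ x₂ y₀ y₁ y₂} α β →
  Recurrence N A x₀ x₁ x₂ → Recurrence N A y₀ y₁ y₂ →
  Recurrence N A (α * x₀ - y₀ * β) (α * x₁ - y₁ * β) (α * x₂ - y₂ * β)
recurrence-combine {N} {A} {x₀} {x₁} {x₂} {y₀} {y₁} {y₂} α β (recurrence rx) (recurrence ry) =
  recurrence (begin
  N * ((α * x₀ - y₀ * β) + (α * x₂ - y₂ * β))
    ≡⟨ solve (N ∷ α ∷ β ∷ x₀ ∷ x₂ ∷ y₀ ∷ y₂ ∷ []) ⟩
  α * (N * (x₀ + x₂)) - N * (y₀ + y₂) * β
    ≡⟨ cong₂ (λ s t → α * s - t * β) rx ry ⟩
  α * (A * x₁) - A * y₁ * β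
    ≡⟨ solve (A ∷ α ∷ β ∷ x₁ ∷ y₁ ∷ []) ⟩
  A * (α * x₁ - y₁ * β) ∎)

recurrence-zero : ∀ {N A x₂} .{{_ : NonZero N}} → Recurrence N A 0ℤ 0ℤ x₂ → x₂ ≡ 0ℤ
recurrence-zero {N} {A} {x₂} (recurrence r) = ℤ.*-cancelˡ-≡ N x₂ 0ℤ (begin
  N * x₂          ≡⟨ cong (N *_) (sym (ℤ.+-identityˡ x₂)) ⟩
  N * (0ℤ + x₂)   ≡⟨ r ⟩
  A * 0ℤ          ≡⟨ ℤ.*-zeroʳ A ⟩
  0ℤ              ≡⟨ ℤ.*-zeroʳ N ⟨
  N * 0ℤ          ∎)

recurrence-of-minors : ∀ {N a b c d e f} → a * e - b * d ≡ N → b * f - c * e ≡ N →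
  Recurrence N (a * f - c * d) a b c × Recurrence N (a * f - c * d) d e f
recurrence-of-minors {N} {a} {b} {c} {d} {e} {f} left≡N right≡N = recurrence upper , recurrence lower
  where
  upper : N * (a + c) ≡ (a * f - c * d) * b
  upper = begin
    N * (a + c)                                ≡⟨ ℤ.*-distribˡ-+ N a c ⟩
    N * a + N * c
      ≡⟨ cong₂ (λ s t → s * a + t * c) (sym right≡N) (sym left≡N) ⟩
    (b * f - c * e) * a + (a * e - b * d) * c  ≡⟨ solve (a ∷ b ∷ c ∷ d ∷ e ∷ f ∷ []) ⟩
    (a * f - c * d) * b                        ∎
  lower : N * (d + f) ≡ (a * f - c * d) * e
  lower = begin
    N * (d + f)                                ≡⟨ ℤ.*-distribˡ-+ N d f ⟩
    N * d + N * f
      ≡⟨ cong₂ (λ s t → s * d + t * f) (sym right≡N) (sym left≡N) ⟩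
    (b * f - c * e) * d + (a * e - b * d) * f  ≡⟨ solve (a ∷ b ∷ c ∷ d ∷ e ∷ f ∷ []) ⟩
    (a * f - c * d) * e                        ∎

-- The left side is N * det3 a b c d e f g h k, unfolded for the solver. Replacing the third
-- column by N (col₁ + col₃) - A col₂ multiplies the determinant by N; the right side
-- expands the result along that column of row residuals.
det3-residual-expansion : ∀ N A a b c d e f g h k →
  N * ((a * (e * k - f * h) - b * (d * k - f * g)) + c * (d * h - e * g)) ≡
  ((N * (a + c) - A * b) * (d * h - e * g) - (N * (d + f) - A * e) * (a * h - b * g))
    + (N * (g + k) - A * h) * (a * e - b * d)
det3-residual-expansion = solve-∀

recurrence-of-singular-rows : ∀ {N A a b c d e f g h k} .{{_ : NonZero N}} →
  Recurrence N A a b c → Recurrence N A d e f → a * e - b * d ≡ N →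
  det3 a b c d e f g h k ≡ 0ℤ → Recurrence N A g h k
recurrence-of-singular-rows {N} {A} {a} {b} {c} {d} {e} {f} {g} {h} {k}
  (recurrence r₁) (recurrence r₂) minor≡N det≡0 =
  recurrence (ℤ.i-j≡0⇒i≡j _ _ (ℤ.*-cancelʳ-≡ residual 0ℤ N (begin
    residual * N
      ≡⟨ cong (residual *_) (sym minor≡N) ⟩
    residual * (a * e - b * d)
      ≡⟨ ℤ.+-identityˡ _ ⟨  -- 0ℤ * x - 0ℤ * y computes to 0ℤ
    (0ℤ * (d * h - e * g) - 0ℤ * (a * h - b * g)) + residual * (a * e - b * d)
      ≡⟨ cong₂ (λ s t → (s * (d * h - e * g) - t * (a * h - b * g)) + residual * (a * e - b * d))
               (ℤ.i≡j⇒i-j≡0 r₁) (ℤ.i≡j⇒i-j≡0 r₂) ⟨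
    ((N * (a + c) - A * b) * (d * h - e * g) - (N * (d + f) - A * e) * (a * h - b * g))
      + residual * (a * e - b * d)
      ≡⟨ det3-residual-expansion N A a b c d e f g h k ⟨
    N * det3 a b c d e f g h k
      ≡⟨ cong (N *_) det≡0 ⟩
    N * 0ℤ
      ≡⟨ ℤ.*-zeroʳ N ⟩
    0ℤ ∎)))
  where
  residual : ℤ
  residual = N * (g + k) - A * h

Window : IndexSet → ℤ → Set
Window K c = mem K c × mem K (c + 1ℤ) × mem K (c + 1ℤ + 1ℤ)

i+[1+n]≡i+n+1 : ∀ i n → i + + suc n ≡ i + + n + 1ℤ
i+[1+n]≡i+n+1 i n = trans (cong (λ x → i + x) (ℤ.+-comm 1ℤ (+ n))) (sym (ℤ.+-assoc i (+ n) 1ℤ))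

i≤j⇒j≡i+∣j-i∣ : ∀ {i j} → i ≤ j → j ≡ i + + ∣ j - i ∣
i≤j⇒j≡i+∣j-i∣ {i} {j} i≤j = begin
  j               ≡⟨ solve (i ∷ j ∷ []) ⟩
  i + (j - i)     ≡⟨ cong (λ x → i + x) (ℤ.0≤i⇒+∣i∣≡i (ℤ.i≤j⇒0≤j-i i≤j)) ⟨
  i + + ∣ j - i ∣ ∎

mem-between : ∀ (K : IndexSet) {a m n} → mem K a → mem K (a + + m) → n ℕ.≤ m → mem K (a + + n)
mem-between K {a} {n = n} a∈K a+m∈K n≤m =
  convex K a∈K a+m∈K (ℤ.i≤i+j a (+ n)) (ℤ.+-monoʳ-≤ a (+≤+ n≤m))

upward-induction₂ : ∀ (K : IndexSet) (P : ℤ → Set) {a} → mem K a → P a → P (a + 1ℤ) →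
  (∀ {c} → Window K c → P c → P (c + 1ℤ) → P (c + 1ℤ + 1ℤ)) →
  ∀ {b} → mem K b → a ≤ b → P b
upward-induction₂ K P {a} a∈K Pa Pa+1 step {b} b∈K a≤b =
  subst P (sym b≡a+n) (go ∣ b - a ∣ (subst (mem K) b≡a+n b∈K))
  where
  b≡a+n : b ≡ a + + ∣ b - a ∣
  b≡a+n = i≤j⇒j≡i+∣j-i∣ a≤b
  go : ∀ n → mem K (a + + n) → P (a + + n)
  go zero          _ = subst P (sym (ℤ.+-identityʳ a)) Pa
  go (suc zero)    _ = Pa+1
  go (suc (suc n)) a+n+2∈K =
    subst P (sym a+n+2≡) (step window (go n a+n∈K) (subst P (i+[1+n]≡i+n+1 a n) (go (suc n) a+n+1∈K)))
    where
    a+n+2≡ : a + + suc (suc n) ≡ a + + n + 1ℤ + 1ℤ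
    a+n+2≡ = trans (i+[1+n]≡i+n+1 a (suc n)) (cong (_+ 1ℤ) (i+[1+n]≡i+n+1 a n))
    a+n∈K : mem K (a + + n)
    a+n∈K = mem-between K a∈K a+n+2∈K (ℕ.m≤n+m n 2)
    a+n+1∈K : mem K (a + + suc n)
    a+n+1∈K = mem-between K a∈K a+n+2∈K (ℕ.n≤1+n (suc n))
    window : Window K (a + + n)
    window = a+n∈K , subst (mem K) (i+[1+n]≡i+n+1 a n) a+n+1∈K , subst (mem K) a+n+2≡ a+n+2∈K

mem-next : ∀ (K : IndexSet) {a b} → mem K a → mem K b → a < b → mem K (a + 1ℤ)
mem-next K {a} a∈K b∈K a<b =
  convex K a∈K b∈K (ℤ.i≤i+j a 1ℤ) (subst (_≤ _) (ℤ.+-comm 1ℤ a) (ℤ.i<j⇒suc[i]≤j a<b))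

module _ (I J : IndexSet) (N : ℤ) (M : Matrix) .{{_ : NonZero N}}
         (tiling : IsTiling I J N M) (tame : IsTame I J M) where

  rows-recur : ∀ {i c} → mem I i → mem I (i + 1ℤ) → Window J c →
    ∀ {k} → mem I k → i ≤ k →
    Recurrence N (Δ M i (i + 1ℤ) c (c + 1ℤ + 1ℤ)) (M k c) (M k (c + 1ℤ)) (M k (c + 1ℤ + 1ℤ))
  rows-recur {i} {c} i∈I i+1∈I (c∈J , c+1∈J , c+2∈J) =
    upward-induction₂ I RowRecurs i∈I (proj₁ top-rows) (proj₂ top-rows) next-row
    where
    RowRecurs : ℤ → Set
    RowRecurs k = Recurrence N (Δ M i (i + 1ℤ) c (c + 1ℤ + 1ℤ)) (M k c) (M k (c + 1ℤ)) (M k (c + 1ℤ + 1ℤ))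
    top-rows : RowRecurs i × RowRecurs (i + 1ℤ)
    top-rows = recurrence-of-minors (tiling i c i∈I i+1∈I c∈J c+1∈J)
                                    (tiling i (c + 1ℤ) i∈I i+1∈I c+1∈J c+2∈J)
    next-row : ∀ {k} → Window I k → RowRecurs k → RowRecurs (k + 1ℤ) → RowRecurs (k + 1ℤ + 1ℤ)
    next-row {k} (k∈I , k+1∈I , k+2∈I) r₀ r₁ =
      recurrence-of-singular-rows r₀ r₁ (tiling k c k∈I k+1∈I c∈J c+1∈J)
                                        (tame k c k∈I k+2∈I c∈J c+2∈J)

  minor-identity : ∀ {i i' j j'} → mem I i → mem I (i + 1ℤ) → mem I i' → i ≤ i' →
    mem J j → mem J (j + 1ℤ) → mem J j' → j ≤ j' →
    N * Δ M i i' j j' ≡ Δ M i (i + 1ℤ) j j' * Δ M i i' j (j + 1ℤ)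
  minor-identity {i} {i'} {j} i∈I i+1∈I i'∈I i≤i' j∈J j+1∈J j'∈J j≤j' =
    ℤ.i-j≡0⇒i≡j _ _
      (upward-induction₂ J (λ c → defect c ≡ 0ℤ) j∈J defect-j defect-j+1 next-column j'∈J j≤j')
    where
    D : ℤ
    D = Δ M i i' j (j + 1ℤ)
    defect : ℤ → ℤ
    defect c = N * Δ M i i' j c - Δ M i (i + 1ℤ) j c * D

    defect-j : defect j ≡ 0ℤ
    defect-j = begin
      N * Δ M i i' j j - Δ M i (i + 1ℤ) j j * D
        ≡⟨ cong₂ (λ s t → N * s - t * D)
                 (ℤ.+-inverseʳ (M i j * M i' j)) (ℤ.+-inverseʳ (M i j * M (i + 1ℤ) j)) ⟩
      N * 0ℤ - 0ℤ * D
        ≡⟨ cong₂ _-_ (ℤ.*-zeroʳ N) (ℤ.*-zeroˡ D) ⟩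
      0ℤ ∎

    defect-j+1 : defect (j + 1ℤ) ≡ 0ℤ
    defect-j+1 = begin
      N * D - Δ M i (i + 1ℤ) j (j + 1ℤ) * D
        ≡⟨ cong (λ t → N * D - t * D) (tiling i j i∈I i+1∈I j∈J j+1∈J) ⟩
      N * D - N * D
        ≡⟨ ℤ.+-inverseʳ (N * D) ⟩
      0ℤ ∎

    next-column : ∀ {c} → Window J c →
      defect c ≡ 0ℤ → defect (c + 1ℤ) ≡ 0ℤ → defect (c + 1ℤ + 1ℤ) ≡ 0ℤ
    next-column {c} window d₀ d₁ =
      recurrence-zero (subst₂ (λ s t → Recurrence N A s t (defect (c + 1ℤ + 1ℤ))) d₀ d₁ defect-recurs)
      where
      A : ℤ
      A = Δ M i (i + 1ℤ) c (c + 1ℤ + 1ℤ)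
      row : ∀ {k} → mem I k → i ≤ k → Recurrence N A (M k c) (M k (c + 1ℤ)) (M k (c + 1ℤ + 1ℤ))
      row = rows-recur i∈I i+1∈I window
      defect-recurs : Recurrence N A (defect c) (defect (c + 1ℤ)) (defect (c + 1ℤ + 1ℤ))
      defect-recurs = recurrence-combine N D
        (recurrence-combine (M i j) (M i' j) (row i'∈I i≤i') (row i∈I ℤ.≤-refl))
        (recurrence-combine (M i j) (M (i + 1ℤ) j) (row i+1∈I (ℤ.i≤i+j i 1ℤ)) (row i∈I ℤ.≤-refl))

lemma3p4 : (I J : IndexSet) (N : ℤ) (M : Matrix) → ¬ (N ≡ 0ℤ) →
    IsTiling I J N M → IsTame I J M →
    ∀ i i' j j' → mem I i → mem I i' → mem J j → mem J j' → i < i' → j < j' →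
    N * Δ M i i' j j' ≡ Δ M i (i + 1ℤ) j j' * Δ M i i' j (j + 1ℤ)
lemma3p4 I J N M N≢0 tiling tame i i' j j' i∈I i'∈I j∈J j'∈J i<i' j<j' =
  minor-identity I J N M {{≢-nonZero N≢0}} tiling tame
    i∈I (mem-next I i∈I i'∈I i<i') i'∈I (ℤ.<⇒≤ i<i')
    j∈J (mem-next J j∈J j'∈J j<j') j'∈J (ℤ.<⇒≤ j<j')
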